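{- Let $X$ be a set, $C$ a simplicial complex with $\bigcup C\subseteq X$, $n\geq1$, $B_0$ a building set of $C$, and for $1\leq i\leq n$ let $B_i$ be a building set of $\widetilde{\mathcal N}(C,B_0,\ldots,B_{i-1})$. Let $B'=\{\sigma^n_X[\beta]\mid\beta\in B_n\}$. Then $\sigma_X^{n+1}$ underlies an isomorphism between $\widetilde{\mathcal N}(C,B_0,\ldots,B_n)$ and $\mathrm{St}_{T^nX}(\mathrm{St}_X(C,B_0,\ldots,B_{n-1}),B')$.
   Context: A simplicial complex is a set $C=P(\alpha_1)\cup\ldots\cup P(\alpha_m)$, $m\ge1$, with $P(\cdot)$ the power set and the $\alpha_i$ finite pairwise $\subseteq$-incomparable sets (bases). $f[S]=\{f(s)\mid s\in S\}$. A function $\psi$ underlies an isomorphism between simplicial complexes $C$ and $D$ if its restriction to $\bigcup C$ is a bijection $\varphi:\bigcup C\to\bigcup D$ with $\alpha\in C$ iff $\varphi[\alpha]\in D$. For a family $B$ and set $\beta$, $B_\beta=B\cap P(\beta)$. A building set of $P(\gamma)$ ($\gamma$ finite) is a set $B$ of nonempty subsets of $\gamma$ with (B1) $\beta,\delta\in B$, $\beta\cap\delta\ne\emptyset$ imply $\beta\cup\delta\in B$, (B2) $\{a\}\in B$ for $a\in\gamma$. A building set of $C$ with bases $\alpha_i$ is $B\subseteq C$ with every $B_{\alpha_i}$ a building set of $P(\alpha_i)$. An $N$-antichain is a set of at least two pairwise $\subseteq$-incomparable members of $N$. For $B\subseteq C$, $N\subseteq B$ is nested if for every $N$-antichain $\{\beta_1,\ldots,\beta_t\}$,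 $\beta_1\cup\ldots\cup\beta_t\in C-B$; $\widetilde{\mathcal N}(C,B)$ is the simplicial complex of nested subsets of $B$; $\widetilde{\mathcal N}(C,B_0,\ldots,B_{i+1})=\widetilde{\mathcal N}(\widetilde{\mathcal N}(C,B_0,\ldots,B_i),B_{i+1})$. For a set $Y$, $TY$ is the free commutative semigroup generated by $Y$ (formal sums $k_1y_1+\ldots+k_ry_r$, $r\ge1$, distinct $y_j$, positive integer $k_j$; $y$ identified with $1y$), $T^1Y=TY$, $T^{m+1}Y=T(T^mY)$. $P_FY$ is the set of finite nonempty subsets of $Y$ and $P_Ff(A)=f[A]$. $\sigma_Y:P_FY\to TY$, $\{a_1,\ldots,a_k\}\mapsto a_1+\ldots+a_k$ (distinct $a_j$); $\sigma^1_Y=\sigma_Y$, $\sigma^{m+1}_Y=\sigma_{T^mY}\circ P_F\sigma^m_Y$. For a simplicial complex $D$ with $\bigcup D\subseteq Y$ and $B\subseteq D$: $\mathrm{St}_Y(D,B)=\{\sigma_Y[N]\mid N\in\widetilde{\mathcal N}(D,B)\}$, and $\mathrm{St}_Y(C,B_0,\ldots,B_k)=\{\sigma^{k+1}_Y[N]\mid N\in\widetilde{\mathcal N}(C,B_0,\ldots,B_k)\}$. -}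

module Defs where

open import Level using (0ℓ)
open import Data.Nat using (ℕ; zero; suc; _≤_)
open import Data.Fin using (Fin)
open import Data.List using (List; []; _∷_; length; lookup; map)
open import Data.List.Relation.Unary.Any using (Any; here; there)
import Data.List.Relation.Unary.Any as Any
open import Data.List.Relation.Unary.All using (All)
open import Data.Product using (Σ; Σ-syntax; _×_; _,_; proj₁; proj₂)
open import Data.Sum using (_⊎_)
open import Relation.Nullary using (¬_)
open import Relation.Binary.Bundles using (Setoid)
open import Relation.Binary.PropositionalEquality as ≡ using (_≡_; _≢_)
open import Function.Bundles using (_⇔_)
import Data.List.Relation.Unary.Unique.Setoid as UniqueS
import Data.List.Relation.Binary.Permutation.Setoid as PermS

module FS (S : Setoid 0ℓ 0ℓ) where
  open Setoid S renaming (Carrier to A)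

  _∈ˡ_ : A → List A → Set
  x ∈ˡ xs = Any (x ≈_) xs

  FinSet : Set
  FinSet = Σ (List A) (UniqueS.Unique S)

  _∈_ : A → FinSet → Set
  x ∈ α = x ∈ˡ proj₁ α

  _⊆_ : FinSet → FinSet → Set
  α ⊆ β = ∀ x → x ∈ α → x ∈ β

  _≐_ : FinSet → FinSet → Set
  α ≐ β = (α ⊆ β) × (β ⊆ α)

  private
    ∈-resp : ∀ {x y} (xs : List A) → x ≈ y → x ∈ˡ xs → y ∈ˡ xs
    ∈-resp xs x≈y p = Any.map (λ x≈z → trans (sym x≈y) x≈z) p

  FinSetoid : Setoid 0ℓ 0ℓ
  FinSetoid = record
    { Carrier = FinSet
    ; _≈_ = _≐_
    ; isEquivalence = record
      { refl = (λ x m → m) , (λ x m → m)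
      ; sym = λ where (p , q) → q , p
      ; trans = λ where (p , q) (r , s) → (λ x m → r x (p x m)) , (λ x m → q x (s x m))
      }
    }

open FS public using (FinSetoid)

-- The free commutative semigroup T Y, realised as finite lists up to
-- permutation (modulo the equality of Y).  Formal sums k₁y₁+…+k_ry_r are
-- multisets; only nonempty lists arise in the statement.

TSetoid : Setoid 0ℓ 0ℓ → Setoid 0ℓ 0ℓ
TSetoid S = PermS.↭-setoid S

module Fam (V : Setoid 0ℓ 0ℓ) where
  open Setoid V renaming (Carrier to A)
  open FS V public using (FinSet; _∈_; _⊆_; _≐_)

  Family : Set₁
  Family = FinSet → Set

  FinSet² : Set
  FinSet² = FS.FinSet (FinSetoid V)

  _∈²_ : FinSet → FinSet² → Set
  β ∈² N = FS._∈_ (FinSetoid V) β N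

  _⊆²_ : FinSet² → FinSet² → Set
  M ⊆² N = FS._⊆_ (FinSetoid V) M N

  NonEmpty : FinSet → Set
  NonEmpty α = Σ A λ x → x ∈ α

  IsUnion : FinSet → FinSet → FinSet → Set
  IsUnion β δ γ = ∀ x → (x ∈ γ) ⇔ (x ∈ β ⊎ x ∈ δ)

  IsBigUnion : FinSet² → FinSet → Set
  IsBigUnion 𝒜 γ = ∀ x → (x ∈ γ) ⇔ Any (λ β → x ∈ β) (proj₁ 𝒜)

  IsSingleton : A → FinSet → Set
  IsSingleton a γ = ∀ x → (x ∈ γ) ⇔ (x ≈ a)

  PairwiseIncomparable : List FinSet → Set
  PairwiseIncomparable xs = ∀ (i j : Fin (length xs)) → i ≢ j → ¬ (lookup xs i ⊆ lookup xs j)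

  IsBasesOf : Family → List FinSet → Set
  IsBasesOf D bases =
    (1 ≤ length bases)
    × PairwiseIncomparable bases
    × (∀ α → D α ⇔ Any (λ b → α ⊆ b) bases)

  IsSimplicialComplex : Family → Set
  IsSimplicialComplex D = Σ (List FinSet) λ bases → IsBasesOf D bases

  IsBuildingSetOfPow : FinSet → Family → Set
  IsBuildingSetOfPow α B =
    (∀ β → B β → β ⊆ α → NonEmpty β)
    × (∀ β δ → B β → β ⊆ α → B δ → δ ⊆ α →
         (Σ A λ x → x ∈ β × x ∈ δ) →
         Σ FinSet λ γ → IsUnion β δ γ × B γ)
    × (∀ a → a ∈ α → Σ FinSet λ γ → IsSingleton a γ × B γ)

  IsBuildingSet : Family → Family → Set
  IsBuildingSet D B =
    -- B is a set of finite sets (respects extensional equality)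
    (∀ β γ → β ≐ γ → B β → B γ)
    × (∀ β → B β → D β)
    × (Σ (List FinSet) λ bases → IsBasesOf D bases × All (λ α → IsBuildingSetOfPow α B) bases)

  IsAntichainIn : FinSet² → FinSet² → Set
  IsAntichainIn 𝒜 N = (𝒜 ⊆² N) × (2 ≤ length (proj₁ 𝒜)) × PairwiseIncomparable (proj₁ 𝒜)

  IsNested : Family → Family → FinSet² → Set
  IsNested D B N = ∀ 𝒜 → IsAntichainIn 𝒜 N →
    Σ FinSet λ γ → IsBigUnion 𝒜 γ × D γ × ¬ B γ

  Ñ : Family → Family → (FinSet² → Set)
  Ñ D B N = (∀ β → β ∈² N → B β) × IsNested D B N

  Vert : Family → A → Set
  Vert D v = Σ FinSet λ α → D α × v ∈ α

module _ (V W : Setoid 0ℓ 0ℓ) where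
  private
    module V = Fam V
    module W = Fam W
    _≈W_ = Setoid._≈_ W
    _≈V_ = Setoid._≈_ V

  IsImage : (Setoid.Carrier V → Setoid.Carrier W) → V.FinSet → W.FinSet → Set
  IsImage f α γ = ∀ y → W._∈_ y γ ⇔ Any (λ x → y ≈W f x) (proj₁ α)

  ImageFamily : (Setoid.Carrier V → Setoid.Carrier W) → V.Family → W.Family
  ImageFamily f D γ = Σ V.FinSet λ N → D N × IsImage f N γ

  UnderliesIso : (Setoid.Carrier V → Setoid.Carrier W) → V.Family → W.Family → Set
  UnderliesIso ψ C D =
    (∀ v → V.Vert C v → W.Vert D (ψ v))
    × (∀ v w → V.Vert C v → V.Vert C w → ψ v ≈W ψ w → v ≈V w)
    × (∀ w → W.Vert D w → Σ (Setoid.Carrier V) λ v → V.Vert C v × ψ v ≈W w)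
    × (∀ α → (∀ v → V._∈_ v α → V.Vert C v) →
         (C α ⇔ (Σ W.FinSet λ γ → IsImage ψ α γ × D γ)))

module Tower (X : Set) where

  Lev : ℕ → Setoid 0ℓ 0ℓ
  Lev zero = ≡.setoid X
  Lev (suc k) = FinSetoid (Lev k)

  TLev : ℕ → Setoid 0ℓ 0ℓ
  TLev zero = ≡.setoid X
  TLev (suc k) = TSetoid (TLev k)

  -- σ_Y : P_F Y → T Y,  {a₁,…,a_k} ↦ a₁+…+a_k
  σ : (Y : Setoid 0ℓ 0ℓ) → FS.FinSet Y → Setoid.Carrier (TSetoid Y)
  σ Y α = proj₁ α

  -- σ^k_X : P_F^k X → T^k X  (σ⁰ = id, σ^{k+1} = σ_{T^k X} ∘ P_F σ^k)
  σ^ : (k : ℕ) → Setoid.Carrier (Lev k) → Setoid.Carrier (TLev k)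
  σ^ zero x = x
  σ^ (suc k) α = map (σ^ k) (proj₁ α)

  St : (Y : Setoid 0ℓ 0ℓ) → Fam.Family Y → Fam.Family Y → Fam.Family (TSetoid Y)
  St Y D B = ImageFamily (FinSetoid Y) (TSetoid Y) (σ Y) (Fam.Ñ Y D B)

  module Seq (C : Fam.Family (Lev 0)) where
    mutual
      BuildSeq : ℕ → Set₁
      BuildSeq zero = Σ (Fam.Family (Lev 0)) λ B → Fam.IsBuildingSet (Lev 0) C B
      BuildSeq (suc k) = Σ (BuildSeq k) λ t →
        Σ (Fam.Family (Lev (suc k))) λ B → Fam.IsBuildingSet (Lev (suc k)) (NT k t) B

      NT : (k : ℕ) → BuildSeq k → Fam.Family (Lev (suc k))
      NT zero (B , _) = Fam.Ñ (Lev 0) C B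
      NT (suc k) (t , B , _) = Fam.Ñ (Lev (suc k)) (NT k t) B

    StSeq : (k : ℕ) → BuildSeq k → Fam.Family (TLev (suc k))
    StSeq k t = ImageFamily (Lev (suc k)) (TLev (suc k)) (σ^ (suc k)) (NT k t)

-- σ^{n+1} = σ ∘ P_F σ^n composes taking images under the injection f = σ^n with the formal
-- sum σ, which is injective because duplicate-free lists with the same members are
-- permutations of each other.  Taking images under an injection preserves and reflects
-- inclusion, unions, antichains and membership in ≐-closed families, so N is nested for
-- (K, B) iff f[N] is nested for (f[K], f[B]); of the building-set axioms only the ≐-closure
-- of B is used.  Every vertex of the target complex is σ(f[β]) for some β ∈ B, and the
-- singleton {β} is nested, which gives surjectivity on vertices.

module Submission where

open import Level using (0ℓ)
open import Data.Nat using (ℕ; zero; suc; _≤_; s≤s)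
open import Data.Fin using (Fin; cast) renaming (zero to fzero; suc to fsuc)
open import Data.Fin.Properties using (cast-involutive)
open import Data.List using (List; []; _∷_; _++_; length; lookup; map)
open import Data.List.Properties using (length-map)
open import Data.List.Relation.Unary.Any using (Any; here; there)
import Data.List.Relation.Unary.Any as Any
import Data.List.Relation.Unary.Any.Properties as Any
open import Data.List.Relation.Unary.All using (All; []; _∷_; lookupₛ)
open import Data.List.Relation.Unary.All.Properties using (All¬⇒¬Any)
open import Data.List.Relation.Unary.AllPairs using ([]; _∷_)
open import Data.List.Relation.Binary.Pointwise using (Pointwise; []; _∷_; lookup⁺; Pointwise-length)
import Data.List.Relation.Binary.Pointwise.Properties as Pointwise
import Data.List.Relation.Binary.Equality.Setoid as Equality
import Data.List.Relation.Binary.Subset.Setoid as Subset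
import Data.List.Relation.Binary.Subset.Setoid.Properties as SubsetP
import Data.List.Membership.Setoid as Membership
open import Data.List.Membership.Setoid.Properties using (∈-resp-≈; ∈-resp-≋; ∈-∃++)
import Data.List.Relation.Unary.Unique.Setoid as UniqueS
import Data.List.Relation.Unary.Unique.Setoid.Properties as UniqueP
import Data.List.Relation.Binary.Permutation.Setoid as PermS
import Data.List.Relation.Binary.Permutation.Setoid.Properties as PermP
open import Data.Product using (Σ; _×_; _,_; proj₁; proj₂)
open import Data.Empty using (⊥-elim)
open import Function using (_∘_; id)
open import Function.Bundles using (Injection; _⇔_; mk⇔; Equivalence)
open import Function.Definitions using (Congruent; Injective)
import Function.Construct.Composition as Composition
open import Relation.Nullary using (¬_)
open import Relation.Binary.Bundles using (Setoid)
open import Relation.Binary.PropositionalEquality as ≡ using (_≡_; _≢_)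
open import Defs

open Equivalence using (to; from)

PairwiseIncomparableBy : {A : Set} → (A → A → Set) → List A → Set
PairwiseIncomparableBy _≤_ xs = ∀ (i j : Fin (length xs)) → i ≢ j → ¬ (lookup xs i ≤ lookup xs j)

cast-injective : ∀ {m n} .(m≡n : m ≡ n) {i j : Fin m} → cast m≡n i ≡ cast m≡n j → i ≡ j
cast-injective m≡n {i} {j} eq = begin
  i                                    ≡⟨ ≡.sym (cast-involutive (≡.sym m≡n) m≡n i) ⟩
  cast (≡.sym m≡n) (cast m≡n i)       ≡⟨ ≡.cong (cast (≡.sym m≡n)) eq ⟩
  cast (≡.sym m≡n) (cast m≡n j)       ≡⟨ cast-involutive (≡.sym m≡n) m≡n j ⟩
  j                                    ∎
  where open ≡.≡-Reasoning

incomparable-pullback :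
  {A B : Set} {_≤ᴬ_ : A → A → Set} {_≤ᴮ_ : B → B → Set} {R : A → B → Set} {xs : List A} {ys : List B} →
  Pointwise R xs ys →
  (∀ {x x′ y y′} → R x y → R x′ y′ → x ≤ᴬ x′ → y ≤ᴮ y′) →
  PairwiseIncomparableBy _≤ᴮ_ ys → PairwiseIncomparableBy _≤ᴬ_ xs
incomparable-pullback rs mono incomparable i j i≢j xᵢ≤xⱼ =
  incomparable (cast e i) (cast e j) (i≢j ∘ cast-injective e) (mono (lookup⁺ rs i) (lookup⁺ rs j) xᵢ≤xⱼ)
  where e = Pointwise-length rs

≋-map⇒Pointwise :
  {S : Setoid 0ℓ 0ℓ} {A : Set} {f : A → Setoid.Carrier S} {ys : List (Setoid.Carrier S)} {xs : List A} →
  Equality._≋_ S ys (map f xs) → Pointwise (λ y x → Setoid._≈_ S y (f x)) ys xs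
≋-map⇒Pointwise {xs = []} [] = []
≋-map⇒Pointwise {S} {f = f} {xs = _ ∷ _} (y≈fx ∷ ys≋) = y≈fx ∷ ≋-map⇒Pointwise {S = S} {f = f} ys≋

module _ (S : Setoid 0ℓ 0ℓ) where
  open Setoid S
  open Membership S using (_∈_)
  open Subset S using (_⊆_)
  open PermS S using (_↭_; ↭-refl; ↭-sym; ↭-trans; ↭-prep; ↭-reflexive-≋)
  open PermP S using (∈-resp-↭; Unique-resp-↭; shift)
  open UniqueS S using (Unique)

  ∈⇒↭∷ : ∀ {x xs} → x ∈ xs → Σ (List Carrier) λ ys → xs ↭ x ∷ ys
  ∈⇒↭∷ x∈xs with ∈-∃++ S x∈xs
  ... | as , bs , w , x≈w , xs≋ = as ++ bs , ↭-trans (↭-reflexive-≋ xs≋) (shift (sym x≈w) as bs)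

  unique-⊆-⊇⇒↭ : ∀ {xs ys} → Unique xs → Unique ys → xs ⊆ ys → ys ⊆ xs → xs ↭ ys
  unique-⊆-⊇⇒↭ {[]} {[]} _ _ _ _ = ↭-refl
  unique-⊆-⊇⇒↭ {[]} {_ ∷ _} _ _ _ ys⊆[] with ys⊆[] (here refl)
  ... | ()
  unique-⊆-⊇⇒↭ {x ∷ xs} {ys} (x∉xs ∷ xs!) ys! xs⊆ys ys⊆xs with ∈⇒↭∷ (xs⊆ys (here refl))
  ... | ys′ , ys↭ with Unique-resp-↭ ys↭ ys!
  ...   | x∉ys′ ∷ ys′! =
    ↭-trans (↭-prep x (unique-⊆-⊇⇒↭ xs! ys′! xs⊆ys′ ys′⊆xs)) (↭-sym ys↭)
    where
    member-of-tail : ∀ {z us vs} → All (λ u → ¬ x ≈ u) us → z ∈ us → z ∈ x ∷ vs → z ∈ vs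
    member-of-tail x∉us z∈us (here z≈x) = ⊥-elim (All¬⇒¬Any x∉us (∈-resp-≈ S z≈x z∈us))
    member-of-tail _ _ (there z∈vs) = z∈vs

    xs⊆ys′ : xs ⊆ ys′
    xs⊆ys′ z∈xs = member-of-tail x∉xs z∈xs (∈-resp-↭ ys↭ (xs⊆ys (there z∈xs)))

    ys′⊆xs : ys′ ⊆ xs
    ys′⊆xs z∈ys′ = member-of-tail x∉ys′ z∈ys′ (ys⊆xs (∈-resp-↭ (↭-sym ys↭) (there z∈ys′)))

  σ-injection : Injection (FinSetoid S) (TSetoid S)
  σ-injection = record
    { to = proj₁
    ; cong = λ {α} {β} (α⊆β , β⊆α) → unique-⊆-⊇⇒↭ (proj₂ α) (proj₂ β) (α⊆β _) (β⊆α _)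
    ; injective = λ α↭β → (λ _ → ∈-resp-↭ α↭β) , (λ _ → ∈-resp-↭ (↭-sym α↭β))
    }

module Image {V W : Setoid 0ℓ 0ℓ} (ι : Injection V W) where
  open Injection ι using (injective) renaming (to to f)
  private
    module V = Setoid V
    module W = Setoid W
  open FS V using () renaming (FinSet to FinSetⱽ; _∈_ to _∈ⱽ_; _⊆_ to _⊆ⱽ_; _≐_ to _≐ⱽ_)
  open FS W using () renaming (FinSet to FinSetᵂ; _∈_ to _∈ᵂ_; _⊆_ to _⊆ᵂ_; _≐_ to _≐ᵂ_)
  open Equality W using (_≋_)

  image : FinSetⱽ → FinSetᵂ
  image α = map f (proj₁ α) , UniqueP.map⁺ V W injective (proj₂ α)

  ∈-image⁺ : ∀ {x y} α → y W.≈ f x → x ∈ⱽ α → y ∈ᵂ image α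
  ∈-image⁺ _ y≈fx x∈α = Any.map⁺ (Any.map (λ x≈z → W.trans y≈fx (Injection.cong ι x≈z)) x∈α)

  ∈-image⁻ : ∀ {y} α → y ∈ᵂ image α → Σ V.Carrier λ x → x ∈ⱽ α × y W.≈ f x
  ∈-image⁻ _ = Membership.find V ∘ Any.map⁻

  f-∈-image⁻ : ∀ {x} α → f x ∈ᵂ image α → x ∈ⱽ α
  f-∈-image⁻ _ = Any.map injective ∘ Any.map⁻

  image-mono : ∀ α β → α ⊆ⱽ β → image α ⊆ᵂ image β
  image-mono α β α⊆β y y∈ with ∈-image⁻ α y∈
  ... | x , x∈α , y≈fx = ∈-image⁺ β y≈fx (α⊆β x x∈α)

  image-reflects-⊆ : ∀ α β → image α ⊆ᵂ image β → α ⊆ⱽ β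
  image-reflects-⊆ α β fα⊆fβ x x∈α = f-∈-image⁻ β (fα⊆fβ (f x) (∈-image⁺ α W.refl x∈α))

  image-injection : Injection (FinSetoid V) (FinSetoid W)
  image-injection = record
    { to = image
    ; cong = λ {α} {β} (α⊆β , β⊆α) → image-mono α β α⊆β , image-mono β α β⊆α
    ; injective = λ {α} {β} (fα⊆fβ , fβ⊆fα) →
                    image-reflects-⊆ α β fα⊆fβ , image-reflects-⊆ β α fβ⊆fα
    }

  IsImage⇔≐image : ∀ α γ → IsImage V W f α γ ⇔ (γ ≐ᵂ image α)
  IsImage⇔≐image _ _ = mk⇔
    (λ γ-img → (λ y → Any.map⁺ ∘ to (γ-img y)) , (λ y → from (γ-img y) ∘ Any.map⁻))
    (λ (γ⊆ , ⊆γ) y → mk⇔ (Any.map⁻ ∘ γ⊆ y) (⊆γ y ∘ Any.map⁺))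

  isImage-image : ∀ α → IsImage V W f α (image α)
  isImage-image α = from (IsImage⇔≐image α (image α)) (Setoid.refl (FinSetoid W) {image α})

  IsImage-injective : ∀ α β γ → IsImage V W f α γ → IsImage V W f β γ → α ≐ⱽ β
  IsImage-injective α β γ γ-img γ-img′ =
    Injection.injective image-injection {α} {β}
      (Setoid.trans (FinSetoid W) {image α} {γ} {image β}
        (Setoid.sym (FinSetoid W) {γ} {image α} (to (IsImage⇔≐image α γ) γ-img))
        (to (IsImage⇔≐image β γ) γ-img′))

  isImage-∘⇒isImage-image :
    {Z : Setoid 0ℓ 0ℓ} (g : W.Carrier → Setoid.Carrier Z) (α : FinSetⱽ) (γ : FS.FinSet Z) →
    IsImage V Z (g ∘ f) α γ → IsImage W Z g (image α) γ
  isImage-∘⇒isImage-image g _ _ γ-img y = mk⇔ (Any.map⁺ ∘ to (γ-img y)) (from (γ-img y) ∘ Any.map⁻)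

  preimages : ∀ α (ys : List W.Carrier) → (∀ y → Any (y W.≈_) ys → y ∈ᵂ image α) →
    Σ (List V.Carrier) λ xs → All (_∈ⱽ α) xs × ys ≋ map f xs
  preimages _ [] _ = [] , [] , []
  preimages α (y ∷ ys) ys⊆ with ∈-image⁻ α (ys⊆ y (here W.refl)) | preimages α ys (λ z → ys⊆ z ∘ there)
  ... | x , x∈α , y≈fx | xs , xs⊆α , ys≋ = x ∷ xs , x∈α ∷ xs⊆α , y≈fx ∷ ys≋

σ∘image-injection : {V W : Setoid 0ℓ 0ℓ} → Injection V W → Injection (FinSetoid V) (TSetoid W)
σ∘image-injection {W = W} ι = Composition.injection (Image.image-injection ι) (σ-injection W)

module NestedSets (S : Setoid 0ℓ 0ℓ) where
  open Fam S
  open FS (FinSetoid S) using () renaming (_≐_ to _≐²_)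
  private
    module S² = Setoid (FinSetoid S)

  Ñ-⊆ : ∀ {D B} N N′ → N′ ⊆² N → Ñ D B N → Ñ D B N′
  Ñ-⊆ N N′ N′⊆N (N⊆B , nested) =
    (λ β → N⊆B β ∘ N′⊆N β) ,
    (λ 𝒜 (𝒜⊆N′ , 2≤∣𝒜∣ , incomparable) → nested 𝒜 ((λ β → N′⊆N β ∘ 𝒜⊆N′ β) , 2≤∣𝒜∣ , incomparable))

  singleton : FinSet → FinSet²
  singleton β = β ∷ [] , [] ∷ []

  Ñ-singleton : ∀ {D B} → (∀ β γ → β ≐ γ → B β → B γ) → ∀ β → B β → Ñ D B (singleton β)
  Ñ-singleton {D} {B} B-resp β Bβ = singleton⊆B , no-antichain
    where
    singleton⊆B : ∀ γ → γ ∈² singleton β → B γ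
    singleton⊆B γ (here γ≐β) = B-resp β γ (S².sym {γ} {β} γ≐β) Bβ

    no-antichain : IsNested D B (singleton β)
    no-antichain ([] , _) (_ , () , _)
    no-antichain (_ ∷ [] , _) (_ , s≤s () , _)
    no-antichain (δ ∷ δ′ ∷ _ , _) (𝒜⊆ , _ , incomparable)
      with 𝒜⊆ δ (here (S².refl {δ})) | 𝒜⊆ δ′ (there (here (S².refl {δ′})))
    ... | here (δ⊆β , _) | here (_ , β⊆δ′) =
      ⊥-elim (incomparable fzero (fsuc fzero) (λ ()) (λ x → β⊆δ′ x ∘ δ⊆β x))

  IsBigUnion-resp : ∀ 𝒜 𝒜′ γ γ′ → IsBigUnion 𝒜 γ → 𝒜 ≐² 𝒜′ → γ ≐ γ′ → IsBigUnion 𝒜′ γ′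
  IsBigUnion-resp 𝒜 𝒜′ γ γ′ ⋃𝒜≡γ (𝒜⊆𝒜′ , 𝒜′⊆𝒜) (γ⊆γ′ , γ′⊆γ) x = mk⇔
    (Any-resp-⊆ (λ {β} → 𝒜⊆𝒜′ β) ∘ to (⋃𝒜≡γ x) ∘ γ′⊆γ x)
    (γ⊆γ′ x ∘ from (⋃𝒜≡γ x) ∘ Any-resp-⊆ (λ {β} → 𝒜′⊆𝒜 β))
    where
    Any-resp-⊆ : ∀ {𝒳 𝒴} → Subset._⊆_ (FinSetoid S) 𝒳 𝒴 → Any (x ∈_) 𝒳 → Any (x ∈_) 𝒴
    Any-resp-⊆ = SubsetP.Any-resp-⊆ (FinSetoid S) (λ {β} {β′} (β⊆β′ , _) → β⊆β′ x)

module NestedTransport {V W : Setoid 0ℓ 0ℓ} (ι : Injection V W) (K B : Fam.Family V)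
                       (B-resp : ∀ β γ → FS._≐_ V β γ → B β → B γ) where
  open Injection ι using () renaming (to to f)
  open Image ι
  open Image image-injection using ()
    renaming ( image to image²; image-mono to image²-mono; ∈-image⁺ to ∈-image²⁺; ∈-image⁻ to ∈-image²⁻
             ; preimages to preimages²; isImage-∘⇒isImage-image to isImage-∘⇒isImage-image² )
  open NestedSets using (Ñ-⊆; singleton; Ñ-singleton; IsBigUnion-resp)
  private
    module V = Fam V
    module W = Fam W
    V² = FinSetoid V
    W² = FinSetoid W
    T = TSetoid W
    module W² = Setoid W²
    module W³ = Setoid (FinSetoid W²)
    open PermS W using (_↭_; ↭-refl; ↭-sym; ↭-trans)

  K′ B′ : Fam.Family W
  K′ = ImageFamily V W f K
  B′ = ImageFamily V W f B

  B′-image⇔ : ∀ β → B′ (image β) ⇔ B β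
  B′-image⇔ β = mk⇔
    (λ (β′ , Bβ′ , fβ-img) → B-resp β′ β (IsImage-injective β′ β (image β) fβ-img (isImage-image β)) Bβ′)
    (λ Bβ → β , Bβ , isImage-image β)

  IsBigUnion-image⇔ : ∀ 𝒜 γ → V.IsBigUnion 𝒜 γ ⇔ W.IsBigUnion (image² 𝒜) (image γ)
  IsBigUnion-image⇔ 𝒜 γ = mk⇔ image-union preimage-union
    where
    image-union : V.IsBigUnion 𝒜 γ → W.IsBigUnion (image² 𝒜) (image γ)
    image-union ⋃𝒜≡γ y = mk⇔ ⊆⋃ ⋃⊆
      where
      ⊆⋃ : y W.∈ image γ → Any (y W.∈_) (map image (proj₁ 𝒜))
      ⊆⋃ y∈fγ with ∈-image⁻ γ y∈fγ
      ... | x , x∈γ , y≈fx = Any.map⁺ (Any.map (λ {β} → ∈-image⁺ β y≈fx) (to (⋃𝒜≡γ x) x∈γ))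
      ⋃⊆ : Any (y W.∈_) (map image (proj₁ 𝒜)) → y W.∈ image γ
      ⋃⊆ y∈⋃ with Membership.find V² (Any.map⁻ y∈⋃)
      ... | β , β∈𝒜 , y∈fβ with ∈-image⁻ β y∈fβ
      ... | x , x∈β , y≈fx = ∈-image⁺ γ y≈fx (from (⋃𝒜≡γ x) (Any.map (λ (β⊆ , _) → β⊆ x x∈β) β∈𝒜))
    preimage-union : W.IsBigUnion (image² 𝒜) (image γ) → V.IsBigUnion 𝒜 γ
    preimage-union ⋃f𝒜≡fγ x = mk⇔
      (Any.map (λ {β} → f-∈-image⁻ β) ∘ Any.map⁻ ∘ to (⋃f𝒜≡fγ (f x)) ∘ ∈-image⁺ γ (Setoid.refl W))
      (f-∈-image⁻ γ ∘ from (⋃f𝒜≡fγ (f x)) ∘ Any.map⁺ ∘ Any.map (λ {β} → ∈-image⁺ β (Setoid.refl W)))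

  antichain-image : ∀ 𝒜 α → V.IsAntichainIn 𝒜 α → W.IsAntichainIn (image² 𝒜) (image² α)
  antichain-image 𝒜 α (𝒜⊆α , 2≤∣𝒜∣ , incomparable) =
    image²-mono 𝒜 α 𝒜⊆α ,
    ≡.subst (2 ≤_) (≡.sym (length-map image (proj₁ 𝒜))) 2≤∣𝒜∣ ,
    incomparable-pullback {_≤ᴬ_ = W._⊆_} {_≤ᴮ_ = V._⊆_} {ys = proj₁ 𝒜}
      (≋-map⇒Pointwise {S = W²} {f = image} {xs = proj₁ 𝒜} (Equality.≋-refl W²))
      (λ {δ} {δ′} {β} {β′} (_ , fβ⊆δ) (δ′⊆fβ′ , _) δ⊆δ′ →
        image-reflects-⊆ β β′ (λ y → δ′⊆fβ′ y ∘ δ⊆δ′ y ∘ fβ⊆δ y))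
      incomparable

  antichain-preimage : ∀ α 𝒜′ → W.IsAntichainIn 𝒜′ (image² α) →
    Σ V.FinSet² λ 𝒜 → V.IsAntichainIn 𝒜 α × FS._≐_ W² 𝒜′ (image² 𝒜)
  antichain-preimage α 𝒜′ (𝒜′⊆fα , 2≤∣𝒜′∣ , incomparable) with preimages² α (proj₁ 𝒜′) 𝒜′⊆fα
  ... | bs , bs⊆α , 𝒜′≋ = (bs , bs-unique) , (𝒜⊆α , 2≤∣bs∣ , bs-incomparable) , 𝒜′≐f𝒜
    where
    bs-unique : UniqueS.Unique V² bs
    bs-unique = UniqueP.map⁻ V² W² (λ {β} {β′} → Injection.cong image-injection {β} {β′})
                  (Equality.Unique-resp-≋ W² 𝒜′≋ (proj₂ 𝒜′))

    𝒜⊆α : (bs , bs-unique) V.⊆² α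
    𝒜⊆α β = lookupₛ V² {P = V._∈² α} (λ {β₁} {β₂} → ∈-resp-≈ V² {proj₁ α} {β₁} {β₂}) bs⊆α {β}

    2≤∣bs∣ : 2 ≤ length bs
    2≤∣bs∣ = ≡.subst (2 ≤_) (≡.trans (Pointwise-length 𝒜′≋) (length-map image bs)) 2≤∣𝒜′∣

    bs-incomparable : V.PairwiseIncomparable bs
    bs-incomparable = incomparable-pullback {_≤ᴬ_ = V._⊆_} {_≤ᴮ_ = W._⊆_} {xs = bs} {ys = proj₁ 𝒜′}
      (Pointwise.symmetric id (≋-map⇒Pointwise {S = W²} {f = image} 𝒜′≋))
      (λ {β} {β′} {δ} {δ′} (δ⊆fβ , _) (_ , fβ′⊆δ′) β⊆β′ y →
        fβ′⊆δ′ y ∘ image-mono β β′ β⊆β′ y ∘ δ⊆fβ y)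
      incomparable

    𝒜′≐f𝒜 : FS._≐_ W² 𝒜′ (image² (bs , bs-unique))
    𝒜′≐f𝒜 = (λ δ → ∈-resp-≋ W² {δ} 𝒜′≋) , (λ δ → ∈-resp-≋ W² {δ} (Equality.≋-sym W² 𝒜′≋))

  Ñ-image : ∀ α → V.Ñ K B α → W.Ñ K′ B′ (image² α)
  Ñ-image α (α⊆B , nested) = fα⊆B′ , nested′
    where
    fα⊆B′ : ∀ δ → δ W.∈² image² α → B′ δ
    fα⊆B′ δ δ∈fα with ∈-image²⁻ {δ} α δ∈fα
    ... | β , β∈α , δ≐fβ = β , α⊆B β β∈α , from (IsImage⇔≐image β δ) δ≐fβ

    nested′ : W.IsNested K′ B′ (image² α)
    nested′ 𝒜′ antichain′ with antichain-preimage α 𝒜′ antichain′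
    ... | 𝒜 , antichain , 𝒜′≐f𝒜 with nested 𝒜 antichain
    ... | γ , ⋃𝒜≡γ , Kγ , ¬Bγ =
      image γ ,
      IsBigUnion-resp W (image² 𝒜) 𝒜′ (image γ) (image γ) (to (IsBigUnion-image⇔ 𝒜 γ) ⋃𝒜≡γ)
        (W³.sym {𝒜′} {image² 𝒜} 𝒜′≐f𝒜) (W².refl {image γ}) ,
      (γ , Kγ , isImage-image γ) ,
      ¬Bγ ∘ to (B′-image⇔ γ)

  Ñ-preimage : ∀ α → W.Ñ K′ B′ (image² α) → V.Ñ K B α
  Ñ-preimage α (fα⊆B′ , nested′) = α⊆B , nested
    where
    α⊆B : ∀ β → β V.∈² α → B β
    α⊆B β β∈α = to (B′-image⇔ β) (fα⊆B′ (image β) (∈-image²⁺ {β} {image β} α (W².refl {image β}) β∈α))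

    nested : V.IsNested K B α
    nested 𝒜 antichain with nested′ (image² 𝒜) (antichain-image 𝒜 α antichain)
    ... | γ′ , ⋃f𝒜≡γ′ , (γ , Kγ , γ′-img) , ¬B′γ′ =
      γ ,
      from (IsBigUnion-image⇔ 𝒜 γ)
        (IsBigUnion-resp W (image² 𝒜) (image² 𝒜) γ′ (image γ) ⋃f𝒜≡γ′
          (W³.refl {image² 𝒜}) (to (IsImage⇔≐image γ γ′) γ′-img)) ,
      Kγ ,
      λ Bγ → ¬B′γ′ (γ , Bγ , γ′-img)

  C : Fam.Family V²
  C = V.Ñ K B

  D : Fam.Family T
  D = ImageFamily W² T proj₁ (W.Ñ K′ B′)

  open Image (σ∘image-injection ι) using ()
    renaming (image to imageψ; ∈-image⁺ to ∈-imageψ⁺; isImage-image to isImageψ-image)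

  ψ : V.FinSet → List (Setoid.Carrier W)
  ψ = Injection.to (σ∘image-injection ι)

  D-imageψ : ∀ α → C α → D (imageψ α)
  D-imageψ α Cα =
    image² α , Ñ-image α Cα , isImage-∘⇒isImage-image² {Z = T} proj₁ α (imageψ α) (isImageψ-image α)

  C-preimageψ : ∀ α γ → IsImage V² T ψ α γ → D γ → C α
  C-preimageψ α γ γ-img (N , ÑN , γ-imgN) = Ñ-preimage α (Ñ-⊆ W N (image² α) fα⊆N ÑN)
    where
    fα⊆N : image² α W.⊆² N
    fα⊆N = proj₁ (Image.IsImage-injective (σ-injection W) (image² α) N γ
                    (isImage-∘⇒isImage-image² {Z = T} proj₁ α γ γ-img) γ-imgN)

  underliesIso : UnderliesIso V² T ψ C D
  underliesIso =
    vertex-image ,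
    (λ β β′ _ _ → Injection.injective (σ∘image-injection ι) {β} {β′}) ,
    vertex-preimage ,
    λ α _ → mk⇔ (λ Cα → imageψ α , isImageψ-image α , D-imageψ α Cα)
                (λ (γ , γ-img , Dγ) → C-preimageψ α γ γ-img Dγ)
    where
    vertex-image : ∀ β → Fam.Vert V² C β → Fam.Vert T D (ψ β)
    vertex-image β (α , Cα , β∈α) = imageψ α , D-imageψ α Cα , ∈-imageψ⁺ {β} α ↭-refl β∈α

    vertex-preimage : ∀ w → Fam.Vert T D w → Σ V.FinSet λ β → Fam.Vert V² C β × ψ β ↭ w
    vertex-preimage w (γ , (N , (N⊆B′ , _) , γ-img) , w∈γ) with Membership.find W² (to (γ-img w) w∈γ)
    ... | δ , δ∈N , w↭δ with N⊆B′ δ δ∈N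
    ... | β , Bβ , δ-img =
      β ,
      (singleton V β , Ñ-singleton V B-resp β Bβ , here (Setoid.refl V² {β})) ,
      ↭-trans (Injection.cong (σ-injection W) {image β} {δ} (W².sym {δ} {image β} (to (IsImage⇔≐image β δ) δ-img)))
              (↭-sym w↭δ)

module _ (X : Set) where
  open Tower X

  σ^-injection : ∀ k → Injection (Lev k) (TLev k)
  σ^-cong : ∀ k → Congruent (Setoid._≈_ (Lev k)) (Setoid._≈_ (TLev k)) (σ^ k)
  σ^-injective : ∀ k → Injective (Setoid._≈_ (Lev k)) (Setoid._≈_ (TLev k)) (σ^ k)

  -- The field `to` is σ^ k itself, not the composite's, so that it unfolds for variable k.
  σ^-injection k = record { to = σ^ k ; cong = σ^-cong k ; injective = σ^-injective k }

  σ^-cong zero = id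
  σ^-cong (suc k) {α} {β} = Injection.cong (σ∘image-injection (σ^-injection k)) {α} {β}

  σ^-injective zero = id
  σ^-injective (suc k) {α} {β} = Injection.injective (σ∘image-injection (σ^-injection k)) {α} {β}

proposition5p5 :
    (X : Set) (C : Fam.Family (Tower.Lev X 0)) →
    Fam.IsSimplicialComplex (Tower.Lev X 0) C →
    (m : ℕ) (t : Tower.Seq.BuildSeq X C m) →
    (Bn : Fam.Family (Tower.Lev X (suc m))) →
    (hB : Fam.IsBuildingSet (Tower.Lev X (suc m)) (Tower.Seq.NT X C m t) Bn) →
    UnderliesIso (Tower.Lev X (suc (suc m))) (Tower.TLev X (suc (suc m)))
      (Tower.σ^ X (suc (suc m)))
      (Tower.Seq.NT X C (suc m) (t , Bn , hB))
      (Tower.St X (Tower.TLev X (suc m))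
        (Tower.Seq.StSeq X C m t)
        (ImageFamily (Tower.Lev X (suc m)) (Tower.TLev X (suc m)) (Tower.σ^ X (suc m)) Bn))
proposition5p5 X C _ m t Bn (Bn-resp , _) =
  NestedTransport.underliesIso (σ^-injection X (suc m)) (Tower.Seq.NT X C m t) Bn Bn-resp
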